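{- Every $\alpha h$-perfect graph is $\omega\chi$-perfect; that is, if $G$ is a finite graph with $\alpha(H)=h(H)$ for every induced subgraph $H$ of $G$, then $\omega(H)=\chi(H)$ for every induced subgraph $H$ of $G$.
   Context: All graphs are finite and simple. A $k$-coloring of $G$ is a surjective map $\varsigma\colon V(G)\to\{1,\dots,k\}$; it is proper if adjacent vertices get different colors, and complete if for every pair of distinct colors $i,j$ there is an edge $xy$ with $\varsigma(x)=i$, $\varsigma(y)=j$. The achromatic number $\alpha(G)$ is the largest $k$ for which $G$ has a proper complete $k$-coloring. The Hadwiger number $h(G)$ is the largest $k$ such that $K_k$ is a minor of $G$. $\omega(G)$ is the clique number and $\chi(G)$ the chromatic number. For parameters $a,b$, $G$ is $ab$-perfect if $a(H)=b(H)$ for all induced subgraphs $H$ of $G$. -}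

module Defs where

open import Data.Nat using (ℕ; _≤_)
open import Data.Fin using (Fin)
open import Data.Bool using (Bool; true; false)
open import Data.Maybe using (Maybe; just; nothing)
open import Data.Product using (Σ; ∃; ∃-syntax; _×_; _,_)
open import Relation.Binary.PropositionalEquality using (_≡_; _≢_)
open import Function.Definitions using (Injective)

record Graph : Set where
  field
    size   : ℕ
    adj    : Fin size → Fin size → Bool
    sym    : ∀ x y → adj x y ≡ adj y x
    irrefl : ∀ x → adj x x ≡ false
open Graph public

Vertex : Graph → Set
Vertex G = Fin (size G)

Edge : (G : Graph) → Vertex G → Vertex G → Set
Edge G x y = adj G x y ≡ true

induced : (G : Graph) (m : ℕ) (f : Fin m → Vertex G) → Injective _≡_ _≡_ f → Graph
induced G m f _ = record
  { size   = m
  ; adj    = λ x y → adj G (f x) (f y)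
  ; sym    = λ x y → sym G (f x) (f y)
  ; irrefl = λ x → irrefl G (f x)
  }

record InducedSubgraph (G : Graph) : Set where
  field
    m     : ℕ
    emb   : Fin m → Vertex G
    emb-inj : Injective _≡_ _≡_ emb

graphOf : {G : Graph} → InducedSubgraph G → Graph
graphOf {G} S = induced G (InducedSubgraph.m S) (InducedSubgraph.emb S) (InducedSubgraph.emb-inj S)

Surjective : {A : Set} {k : ℕ} → (A → Fin k) → Set
Surjective {A} {k} c = ∀ (i : Fin k) → ∃[ x ] c x ≡ i

Proper : (G : Graph) {k : ℕ} → (Vertex G → Fin k) → Set
Proper G c = ∀ x y → Edge G x y → c x ≢ c y

Complete : (G : Graph) {k : ℕ} → (Vertex G → Fin k) → Set
Complete G {k} c = ∀ (i j : Fin k) → i ≢ j →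
  ∃[ x ] ∃[ y ] (Edge G x y × c x ≡ i × c y ≡ j)

HasProperColoring : Graph → ℕ → Set
HasProperColoring G k = Σ (Vertex G → Fin k) λ c → Surjective c × Proper G c

HasCompleteColoring : Graph → ℕ → Set
HasCompleteColoring G k = Σ (Vertex G → Fin k) λ c → Surjective c × Proper G c × Complete G c

HasClique : Graph → ℕ → Set
HasClique G k = Σ (Fin k → Vertex G) λ f → ∀ i j → i ≢ j → Edge G (f i) (f j)

data WalkIn (G : Graph) (P : Vertex G → Set) : Vertex G → Vertex G → Set where
  here : ∀ {x} → P x → WalkIn G P x x
  step : ∀ {x y z} → P x → Edge G x y → WalkIn G P y z → WalkIn G P x z

-- K_k is a minor of G: β assigns each vertex to at most one branch set;
-- branch sets are nonempty, connected, and pairwise joined by an edge.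
HasCliqueMinor : Graph → ℕ → Set
HasCliqueMinor G k = Σ (Vertex G → Maybe (Fin k)) λ β →
    (∀ (i : Fin k) → ∃[ x ] β x ≡ just i)
  × (∀ (i : Fin k) x y → β x ≡ just i → β y ≡ just i → WalkIn G (λ z → β z ≡ just i) x y)
  × (∀ (i j : Fin k) → i ≢ j → ∃[ x ] ∃[ y ] (Edge G x y × β x ≡ just i × β y ≡ just j))

IsMax : (ℕ → Set) → ℕ → Set
IsMax P n = P n × (∀ k → P k → k ≤ n)

IsMin : (ℕ → Set) → ℕ → Set
IsMin P n = P n × (∀ k → P k → n ≤ k)

IsAchromaticNumber : Graph → ℕ → Set
IsAchromaticNumber G = IsMax (HasCompleteColoring G)

IsHadwigerNumber : Graph → ℕ → Set
IsHadwigerNumber G = IsMax (HasCliqueMinor G)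

IsCliqueNumber : Graph → ℕ → Set
IsCliqueNumber G = IsMax (HasClique G)

IsChromaticNumber : Graph → ℕ → Set
IsChromaticNumber G = IsMin (HasProperColoring G)

SameParam : (Graph → ℕ → Set) → (Graph → ℕ → Set) → Graph → Set
SameParam A B H = ∀ a b → A H a → B H b → a ≡ b

Perfect : (Graph → ℕ → Set) → (Graph → ℕ → Set) → Graph → Set
Perfect A B G = ∀ (S : InducedSubgraph G) → SameParam A B (graphOf S)

-- An αh-perfect graph contains neither P₄ (α = 3, h = 2) nor C₄ (α = 2, h = 3) as an induced
-- subgraph. Hence adjacent vertices u, v have nested closed neighborhoods: a private neighbor x
-- of u and a private neighbor y of v would induce the path x u v y, or a 4-cycle if xy is an edge.
-- In a graph with nested neighborhoods a vertex with smallest closed neighborhood is simplicial,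
-- so removing it, coloring the rest with ω colors and giving it a color missing on its clique of
-- neighbors colors the graph with ω colors. Every property involved passes to induced subgraphs.

module Submission where

open import Defs renaming (sym to adj-sym)
open import Data.Bool as Bool using (Bool; true; false; _∨_)
open import Data.Bool.Properties using (∨-comm; ∨-identityʳ; ¬-not)
open import Data.Empty using (⊥-elim)
open import Data.Fin using (Fin; zero; suc; punchIn; punchOut; _≟_)
open import Data.Fin.Patterns using (0F; 1F; 2F; 3F)
open import Data.Fin.Properties
  using (any?; all?; ¬∀⟶∃¬; injective⇒≤; punchIn-injective; punchInᵢ≢i; punchIn-punchOut; punchOut-injective)
open import Data.Fin.Subset using (Subset; _∈_; _∉_; _⊆_; _⊈_; ∣_∣)
open import Data.Fin.Subset.Properties using (_∈?_; _⊆?_; p⊂q⇒∣p∣<∣q∣)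
open import Data.List using (allFin)
open import Data.List.Extrema.Nat using (argmin; f[argmin]≤v⁺)
open import Data.List.Membership.Propositional.Properties using (∈-allFin)
open import Data.List.Relation.Unary.Any as Any using ()
open import Data.Maybe using (Maybe; just; nothing)
open import Data.Maybe.Properties using (just-injective) renaming (≡-dec to ≡-dec-Maybe)
open import Data.Nat using (ℕ; zero; suc; _≤_; _<_; _≤?_; s≤s)
open import Data.Nat.Properties using (≤-refl; ≤-trans; ≤-antisym; ≤⇒≯; ≰⇒>; m≤n⇒m≤1+n; 1+n≰n)
open import Data.Product using (Σ; ∃-syntax; _×_; _,_; proj₁; proj₂)
open import Data.Sum as Sum using (_⊎_; inj₁; inj₂)
open import Data.Vec using (Vec; []; _∷_; lookup; tabulate)
open import Data.Vec.Properties using (lookup∘tabulate; []=⇒lookup; lookup⇒[]=)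
open import Data.Vec.Relation.Unary.AllPairs using ([]; _∷_)
open import Data.Vec.Relation.Unary.All using ([]; _∷_)
open import Data.Vec.Relation.Unary.Unique.Propositional using (Unique)
open import Data.Vec.Relation.Unary.Unique.Propositional.Properties using (lookup-injective)
open import Function using (_∘_)
open import Function.Definitions using (Injective)
open import Relation.Binary.Definitions using (DecidableEquality)
open import Relation.Binary.PropositionalEquality
  using (_≡_; _≢_; refl; sym; trans; cong; subst; subst₂; ≢-sym; module ≡-Reasoning)
open import Relation.Nullary using (¬_; Dec; yes; no; does)
open import Relation.Nullary.Decidable using (toWitness; ¬?; _×-dec_; _⊎-dec_; _→-dec_)

private
  variable
    A : Set
    n k : ℕ
    G : Graph

Covers : (Fin n → A) → (Fin k → A) → Set
Covers g e = ∀ i → ∃[ x ] g x ≡ e i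

covers⇒≤ : {g : Fin n → A} {e : Fin k → A} → Injective _≡_ _≡_ e → Covers g e → k ≤ n
covers⇒≤ {g = g} {e} e-inj cov = injective⇒≤ {f = proj₁ ∘ cov} λ {i} {j} eq → e-inj (begin
  e i                ≡⟨ sym (proj₂ (cov i)) ⟩
  g (proj₁ (cov i))  ≡⟨ cong g eq ⟩
  g (proj₁ (cov j))  ≡⟨ proj₂ (cov j) ⟩
  e j                ∎)
  where open ≡-Reasoning

covers-punchIn : {g : Fin (suc n) → A} {e : Fin k → A} (y : Fin (suc n)) →
                 (∀ i → g y ≡ e i → ∃[ x ] (x ≢ y × g x ≡ e i)) →
                 Covers g e → Covers (g ∘ punchIn y) e
covers-punchIn {g = g} {e} y spare cov i with cov i
... | w , gw≡ei with w ≟ y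
...   | yes refl = skip (spare i gw≡ei)
  where
  skip : ∃[ x ] (x ≢ y × g x ≡ e i) → ∃[ z ] g (punchIn y z) ≡ e i
  skip (x , x≢y , gx≡ei) = punchOut (≢-sym x≢y) , trans (cong g (punchIn-punchOut _)) gx≡ei
...   | no w≢y = punchOut (≢-sym w≢y) , trans (cong g (punchIn-punchOut _)) gw≡ei

tightCover-injective : {g : Fin n → A} {e : Fin k → A} →
  Injective _≡_ _≡_ e → Covers g e → n ≤ k → Injective _≡_ _≡_ g
tightCover-injective {n = suc _} {k = k} e-inj cov n≤k {x} {y} gx≡gy with x ≟ y
... | yes x≡y = x≡y
... | no x≢y  = ⊥-elim (≤⇒≯ (covers⇒≤ e-inj smaller) n≤k)
  where
  smaller = covers-punchIn y (λ i gy≡ei → x , x≢y , trans gx≡gy gy≡ei) cov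

tightCover-hits : {g : Fin n → A} {e : Fin k → A} →
  Injective _≡_ _≡_ e → Covers g e → n ≤ k → ∀ y → ¬ (∀ i → g y ≢ e i)
tightCover-hits {n = suc _} e-inj cov n≤k y missed =
  ≤⇒≯ (covers⇒≤ e-inj (covers-punchIn y (λ i gy≡ei → ⊥-elim (missed i gy≡ei)) cov)) n≤k

∃-uncovered : DecidableEquality A → {e : Fin k → A} → Injective _≡_ _≡_ e → n < k →
              (g : Fin n → A) → ∃[ i ] ∀ x → g x ≢ e i
∃-uncovered {k = k} _≟ᴬ_ {e} e-inj n<k g
  with ¬∀⟶∃¬ k (λ i → ∃[ x ] g x ≡ e i) (λ i → any? λ x → g x ≟ᴬ e i)
                (λ cov → ≤⇒≯ (covers⇒≤ e-inj cov) n<k)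
... | i , missed = i , λ x gx≡ei → missed (x , gx≡ei)

Edge-sym : (G : Graph) → ∀ {x y} → Edge G x y → Edge G y x
Edge-sym G {x} {y} e = trans (adj-sym G y x) e

Edge-irrefl : (G : Graph) → ∀ {x y} → Edge G x y → x ≢ y
Edge-irrefl G {x} e refl with () ← trans (sym (irrefl G x)) e

edge? : (G : Graph) → ∀ x y → Dec (Edge G x y)
edge? G x y = adj G x y Bool.≟ true

Touching : (G : Graph) {B : Set} → (Vertex G → B) → B → B → Set
Touching G β b b′ = ∃[ x ] ∃[ y ] (Edge G x y × β x ≡ b × β y ≡ b′)

touching? : (G : Graph) {B : Set} → DecidableEquality B → (β : Vertex G → B) → ∀ b b′ → Dec (Touching G β b b′)
touching? G _≟ᴮ_ β b b′ = any? λ x → any? λ y → edge? G x y ×-dec β x ≟ᴮ b ×-dec β y ≟ᴮ b′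

isCompleteColoring? : (G : Graph) (c : Vertex G → Fin k) → Dec (Surjective c × Proper G c × Complete G c)
isCompleteColoring? G c =
      (all? λ i → any? λ x → c x ≟ i)
  ×-dec (all? λ x → all? λ y → edge? G x y →-dec ¬? (c x ≟ c y))
  ×-dec (all? λ i → all? λ j → ¬? (i ≟ j) →-dec touching? G _≟_ c i j)

-- Complete partial colorings, common to complete colorings and clique minors

HasCompletePartialColoring : Graph → ℕ → Set
HasCompletePartialColoring G k = Σ (Vertex G → Maybe (Fin k)) λ β →
  Covers β just × (∀ i j → i ≢ j → Touching G β (just i) (just j))

completeColoring⇒partial : HasCompleteColoring G k → HasCompletePartialColoring G k
completeColoring⇒partial {G = G} (c , surj , _ , complete) =
  just ∘ c , cover , touch
  where
  cover : Covers (just ∘ c) just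
  cover i with surj i
  ... | x , cx≡i = x , cong just cx≡i
  touch : ∀ i j → i ≢ j → Touching G (just ∘ c) (just i) (just j)
  touch i j i≢j with complete i j i≢j
  ... | x , y , e , cx≡i , cy≡j = x , y , e , cong just cx≡i , cong just cy≡j

cliqueMinor⇒partial : HasCliqueMinor G k → HasCompletePartialColoring G k
cliqueMinor⇒partial (β , nonempty , _ , touch) = β , nonempty , touch

-- With at least |V| labels every vertex is its own class, so classes touching means vertices adjacent.
partialColoring⇒adjacent : HasCompletePartialColoring G k → size G ≤ k → ∀ {x y} → x ≢ y → Edge G x y
partialColoring⇒adjacent {G = G} (β , cov , touch) n≤k {x} {y} x≢y = adjacent (label x) (label y)
  where
  injective = tightCover-injective just-injective cov n≤k
  label : ∀ z → ∃[ i ] β z ≡ just i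
  label z with β z in βz
  ... | just i  = i , refl
  ... | nothing = ⊥-elim (tightCover-hits just-injective cov n≤k z λ i βz≡i → nothing≢just (trans (sym βz) βz≡i))
    where
    nothing≢just : ∀ {i} → nothing ≢ just i
    nothing≢just ()
  adjacent : ∃[ i ] β x ≡ just i → ∃[ j ] β y ≡ just j → Edge G x y
  adjacent (i , βx) (j , βy) with touch i j (λ { refl → x≢y (injective (trans βx (sym βy))) })
  ... | x′ , y′ , e , βx′ , βy′ =
    subst₂ (Edge G) (injective (trans βx′ (sym βx))) (injective (trans βy′ (sym βy))) e

CliqueBranchSets : (G : Graph) → (Vertex G → Maybe (Fin k)) → Set
CliqueBranchSets G β = Covers β just
  × (∀ x y i → β x ≡ just i → β y ≡ just i → x ≡ y ⊎ Edge G x y)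
  × (∀ i j → i ≢ j → Touching G β (just i) (just j))

cliqueBranchSets⇒minor : {β : Vertex G → Maybe (Fin k)} → CliqueBranchSets G β → HasCliqueMinor G k
cliqueBranchSets⇒minor {G = G} {β = β} (cov , clique , touch) = β , cov , connected , touch
  where
  connected : ∀ i x y → β x ≡ just i → β y ≡ just i → WalkIn G (λ z → β z ≡ just i) x y
  connected i x y βx βy with clique x y i βx βy
  ... | inj₁ refl = here βx
  ... | inj₂ e    = step βx e (here βy)

cliqueBranchSets? : (G : Graph) (β : Vertex G → Maybe (Fin k)) → Dec (CliqueBranchSets G β)
cliqueBranchSets? G β =
      (all? λ i → any? λ x → β x ≟ᴹ just i)
  ×-dec (all? λ x → all? λ y → all? λ i → β x ≟ᴹ just i →-dec β y ≟ᴹ just i →-dec (x ≟ y ⊎-dec edge? G x y))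
  ×-dec (all? λ i → all? λ j → ¬? (i ≟ j) →-dec touching? G _≟ᴹ_ β (just i) (just j))
  where _≟ᴹ_ = ≡-dec-Maybe _≟_

-- An edge between the color classes of x and y would have an endpoint adjacent to both.
commonNeighbors⇒sameColor : {c : Vertex G → Fin k} → Proper G c → Complete G c → ∀ x y →
  (∀ u w → Edge G u w → (Edge G u x × Edge G u y) ⊎ (Edge G w x × Edge G w y)) → c x ≡ c y
commonNeighbors⇒sameColor {c = c} proper complete x y meets with c x ≟ c y
... | yes same = same
... | no differ with complete (c x) (c y) differ
...   | u , w , e , cu≡cx , cw≡cy with meets u w e
...     | inj₁ (ux , _) = ⊥-elim (proper u x ux cu≡cx)
...     | inj₂ (_ , wy) = ⊥-elim (proper w y wy cw≡cy)

inducedOn : (xs : Vec (Vertex G) n) → Unique xs → InducedSubgraph G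
inducedOn xs distinct = record { m = _ ; emb = lookup xs ; emb-inj = λ {i} {j} → lookup-injective distinct i j }

perfect-induced : (P Q : Graph → ℕ → Set) → Perfect P Q G → (S : InducedSubgraph G) → Perfect P Q (graphOf S)
perfect-induced _ _ perfect S T = perfect (record
  { m = InducedSubgraph.m T
  ; emb = InducedSubgraph.emb S ∘ InducedSubgraph.emb T
  ; emb-inj = InducedSubgraph.emb-inj T ∘ InducedSubgraph.emb-inj S
  })

record _≅_ (G H : Graph) : Set where
  field
    to      : Vertex G → Vertex H
    from    : Vertex H → Vertex G
    from-to : ∀ x → from (to x) ≡ x
    to-from : ∀ y → to (from y) ≡ y
    adj-to  : ∀ x y → adj H (to x) (to y) ≡ adj G x y

  edge-to : ∀ {x y} → Edge G x y → Edge H (to x) (to y)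
  edge-to {x} {y} e = trans (adj-to x y) e

  edge-from : ∀ {x y} → Edge H x y → Edge G (from x) (from y)
  edge-from {x} {y} e = trans (sym (adj-to (from x) (from y))) (subst₂ (Edge H) (sym (to-from x)) (sym (to-from y)) e)

  walk-to : ∀ {P x y} → WalkIn G P x y → WalkIn H (P ∘ from) (to x) (to y)
  walk-to {P} (here {x} p)       = here (subst P (sym (from-to x)) p)
  walk-to {P} (step {x} p e w)   = step (subst P (sym (from-to x)) p) (edge-to e) (walk-to w)

  completeColoring : HasCompleteColoring G k → HasCompleteColoring H k
  completeColoring (c , surj , proper , complete) =
    c ∘ from , surj′ , (λ x y e → proper (from x) (from y) (edge-from e)) , complete′
    where
    surj′ : Surjective (c ∘ from)
    surj′ i with surj i
    ... | x , cx≡i = to x , trans (cong c (from-to x)) cx≡i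
    complete′ : Complete H (c ∘ from)
    complete′ i j i≢j with complete i j i≢j
    ... | x , y , e , cx≡i , cy≡j =
      to x , to y , edge-to e , trans (cong c (from-to x)) cx≡i , trans (cong c (from-to y)) cy≡j

  cliqueMinor : HasCliqueMinor G k → HasCliqueMinor H k
  cliqueMinor (β , nonempty , connected , touch) = β ∘ from , nonempty′ , connected′ , touch′
    where
    nonempty′ : ∀ i → ∃[ x ] β (from x) ≡ just i
    nonempty′ i with nonempty i
    ... | x , βx = to x , trans (cong β (from-to x)) βx
    connected′ : ∀ i x y → β (from x) ≡ just i → β (from y) ≡ just i → WalkIn H (λ z → β (from z) ≡ just i) x y
    connected′ i x y βx βy =
      subst₂ (WalkIn H _) (to-from x) (to-from y) (walk-to (connected i (from x) (from y) βx βy))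
    touch′ : ∀ i j → i ≢ j → Touching H (β ∘ from) (just i) (just j)
    touch′ i j i≢j with touch i j i≢j
    ... | x , y , e , βx , βy =
      to x , to y , edge-to e , trans (cong β (from-to x)) βx , trans (cong β (from-to y)) βy

≅-sym : ∀ {H} → G ≅ H → H ≅ G
≅-sym {G = G} {H} iso = record
  { to = from ; from = to ; from-to = to-from ; to-from = from-to
  ; adj-to = λ x y → trans (sym (adj-to (from x) (from y))) (cong₂′ (to-from x) (to-from y)) }
  where
  open _≅_ iso
  cong₂′ : ∀ {x x′ y y′} → x ≡ x′ → y ≡ y′ → adj H x y ≡ adj H x′ y′
  cong₂′ refl refl = refl

IsMax-transfer : {P Q : ℕ → Set} → (∀ {k} → P k → Q k) → (∀ {k} → Q k → P k) → ∀ {a} → IsMax P a → IsMax Q a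
IsMax-transfer P⇒Q Q⇒P (pa , max) = P⇒Q pa , λ k qk → max k (Q⇒P qk)

module _ {H : Graph} (iso : G ≅ H) where

  ≅-achromatic : ∀ {a} → IsAchromaticNumber G a → IsAchromaticNumber H a
  ≅-achromatic = IsMax-transfer (_≅_.completeColoring iso) (_≅_.completeColoring (≅-sym iso))

  ≅-hadwiger : ∀ {a} → IsHadwigerNumber G a → IsHadwigerNumber H a
  ≅-hadwiger = IsMax-transfer (_≅_.cliqueMinor iso) (_≅_.cliqueMinor (≅-sym iso))

quad : Bool → Graph
quad closed = record
  { size = 4 ; adj = λ x y → link x y ∨ link y x ; sym = λ x y → ∨-comm (link x y) (link y x) ; irrefl = irr }
  where
  link : Fin 4 → Fin 4 → Bool
  link 0F 1F = true
  link 1F 2F = true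
  link 2F 3F = true
  link 3F 0F = closed
  link _ _   = false
  irr : ∀ x → link x x ∨ link x x ≡ false
  irr 0F = refl
  irr 1F = refl
  irr 2F = refl
  irr 3F = refl

path₄ cycle₄ : Graph
path₄  = quad false
cycle₄ = quad true

IsMax-intro : {P : ℕ → Set} {a : ℕ} → P a → (∀ {k} → a < k → ¬ P k) → IsMax P a
IsMax-intro {P = P} {a} pa bounded = pa , λ k pk → bound k pk
  where
  bound : ∀ k → P k → k ≤ a
  bound k pk with k ≤? a
  ... | yes k≤a = k≤a
  ... | no k≰a  = ⊥-elim (bounded (≰⇒> k≰a) pk)

path₄-achromatic : IsAchromaticNumber path₄ 3
path₄-achromatic = IsMax-intro (c , toWitness {a? = isCompleteColoring? path₄ c} _) λ 3<k col →
  nonedge (partialColoring⇒adjacent {G = path₄} (completeColoring⇒partial {G = path₄} col) 3<k {0F} {2F} λ ())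
  where
  c : Fin 4 → Fin 3
  c = lookup (0F ∷ 1F ∷ 2F ∷ 0F ∷ [])
  nonedge : ¬ Edge path₄ 0F 2F
  nonedge ()

cycle₄-achromatic : IsAchromaticNumber cycle₄ 2
cycle₄-achromatic = IsMax-intro (c , toWitness {a? = isCompleteColoring? cycle₄ c} _) bound
  where
  c : Fin 4 → Fin 2
  c = lookup (0F ∷ 1F ∷ 0F ∷ 1F ∷ [])
  meets : ∀ x y → Dec (∀ u w → Edge cycle₄ u w → (Edge cycle₄ u x × Edge cycle₄ u y) ⊎ (Edge cycle₄ w x × Edge cycle₄ w y))
  meets x y = all? λ u → all? λ w → edge? cycle₄ u w →-dec
    ((edge? cycle₄ u x ×-dec edge? cycle₄ u y) ⊎-dec (edge? cycle₄ w x ×-dec edge? cycle₄ w y))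
  bound : ∀ {k} → 2 < k → ¬ HasCompleteColoring cycle₄ k
  bound 2<k (c , surj , proper , complete) = ≤⇒≯ (covers⇒≤ (λ eq → eq) cover) 2<k
    where
    c0≡c2 = commonNeighbors⇒sameColor {G = cycle₄} proper complete 0F 2F (toWitness {a? = meets 0F 2F} _)
    c1≡c3 = commonNeighbors⇒sameColor {G = cycle₄} proper complete 1F 3F (toWitness {a? = meets 1F 3F} _)
    cover : Covers (lookup (c 0F ∷ c 1F ∷ [])) (λ i → i)
    cover i with surj i
    ... | 0F , eq = 0F , eq
    ... | 1F , eq = 1F , eq
    ... | 2F , eq = 0F , trans c0≡c2 eq
    ... | 3F , eq = 1F , trans c1≡c3 eq

cycle₄-hadwiger : IsHadwigerNumber cycle₄ 3
cycle₄-hadwiger = IsMax-intro minor λ 3<k minor →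
  nonedge (partialColoring⇒adjacent {G = cycle₄} (cliqueMinor⇒partial minor) 3<k {0F} {2F} λ ())
  where
  branch : Fin 4 → Maybe (Fin 3)
  branch = lookup (just 0F ∷ just 1F ∷ just 2F ∷ just 2F ∷ [])
  minor : HasCliqueMinor cycle₄ 3
  minor = cliqueBranchSets⇒minor (toWitness {a? = cliqueBranchSets? cycle₄ branch} _)
  nonedge : ¬ Edge cycle₄ 0F 2F
  nonedge ()

walk-through-1F : ∀ {P} → WalkIn path₄ P 0F 3F → P 1F
walk-through-1F (step {y = 1F} _ _ (step p _ _)) = p
walk-through-1F (step {y = 0F} _ () _)
walk-through-1F (step {y = 2F} _ () _)
walk-through-1F (step {y = 3F} _ () _)

-- A branch set avoiding both inner vertices lies in {0F, 3F}, and by connectedness not in both,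
-- so its only edge to another branch set is 0F 1F or 3F 2F.
module OuterBranchSet {k} (β : Fin 4 → Maybe (Fin k))
  (connected : ∀ i x y → β x ≡ just i → β y ≡ just i → WalkIn path₄ (λ z → β z ≡ just i) x y)
  {s} (β1≢s : β 1F ≢ just s) (β2≢s : β 2F ≢ just s) where

  touchingSide : ∀ {t} → Touching path₄ β (just s) (just t) →
                 (β 0F ≡ just s × β 1F ≡ just t) ⊎ (β 3F ≡ just s × β 2F ≡ just t)
  touchingSide (0F , 1F , _ , βx , βy) = inj₁ (βx , βy)
  touchingSide (3F , 2F , _ , βx , βy) = inj₂ (βx , βy)
  touchingSide (1F , _  , _ , βx , _)  = ⊥-elim (β1≢s βx)
  touchingSide (2F , _  , _ , βx , _)  = ⊥-elim (β2≢s βx)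
  touchingSide (0F , 0F , () , _)
  touchingSide (0F , 2F , () , _)
  touchingSide (0F , 3F , () , _)
  touchingSide (3F , 0F , () , _)
  touchingSide (3F , 1F , () , _)
  touchingSide (3F , 3F , () , _)

  touches-one : ∀ {t u} → Touching path₄ β (just s) (just t) → Touching path₄ β (just s) (just u) → t ≡ u
  touches-one st su with touchingSide st | touchingSide su
  ... | inj₁ (_ , β1≡t)  | inj₁ (_ , β1≡u)  = just-injective (trans (sym β1≡t) β1≡u)
  ... | inj₂ (_ , β2≡t)  | inj₂ (_ , β2≡u)  = just-injective (trans (sym β2≡t) β2≡u)
  ... | inj₁ (β0≡s , _)  | inj₂ (β3≡s , _)  = ⊥-elim (β1≢s (walk-through-1F (connected s 0F 3F β0≡s β3≡s)))
  ... | inj₂ (β3≡s , _)  | inj₁ (β0≡s , _)  = ⊥-elim (β1≢s (walk-through-1F (connected s 0F 3F β0≡s β3≡s)))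

path₄-hadwiger : IsHadwigerNumber path₄ 2
path₄-hadwiger = IsMax-intro minor no-K₃
  where
  branch : Fin 4 → Maybe (Fin 2)
  branch = lookup (just 0F ∷ just 0F ∷ just 1F ∷ just 1F ∷ [])
  minor : HasCliqueMinor path₄ 2
  minor = cliqueBranchSets⇒minor (toWitness {a? = cliqueBranchSets? path₄ branch} _)
  -- Three branch sets but only two inner vertices: some branch set is outer.
  no-K₃ : ∀ {k} → 2 < k → ¬ HasCliqueMinor path₄ k
  no-K₃ 2<k@(s≤s (s≤s (s≤s _))) (β , _ , connected , touch)
    with ∃-uncovered (≡-dec-Maybe _≟_) just-injective 2<k (lookup (β 1F ∷ β 2F ∷ []))
  ... | s , outer = 0≢1 (punchIn-injective s 0F 1F (touches-one (touch s t (≢-sym (punchInᵢ≢i s 0F)))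
                                                                (touch s u (≢-sym (punchInᵢ≢i s 1F)))))
    where
    open OuterBranchSet β connected (outer 0F) (outer 1F)
    t = punchIn s 0F
    u = punchIn s 1F
    0≢1 : 0F ≢ 1F
    0≢1 ()

quad-not-αh-perfect : ∀ closed → ¬ SameParam IsAchromaticNumber IsHadwigerNumber (quad closed)
quad-not-αh-perfect false same with () ← same 3 2 path₄-achromatic path₄-hadwiger
quad-not-αh-perfect true  same with () ← same 2 3 cycle₄-achromatic cycle₄-hadwiger

closedNbhd : (G : Graph) → Vertex G → Subset (size G)
closedNbhd G u = tabulate λ x → does (x ≟ u) ∨ adj G u x

∈-closedNbhd⁺ : (G : Graph) → ∀ {u x} → x ≡ u ⊎ Edge G u x → x ∈ closedNbhd G u
∈-closedNbhd⁺ G {u} {x} h = lookup⇒[]= x _ (trans (lookup∘tabulate _ x) (member h))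
  where
  member : x ≡ u ⊎ Edge G u x → does (x ≟ u) ∨ adj G u x ≡ true
  member h with x ≟ u | h
  ... | yes _   | _        = refl
  ... | no x≢u  | inj₁ x≡u = ⊥-elim (x≢u x≡u)
  ... | no _    | inj₂ e   = e

∈-closedNbhd⁻ : (G : Graph) → ∀ {u x} → x ∈ closedNbhd G u → x ≡ u ⊎ Edge G u x
∈-closedNbhd⁻ G {u} {x} x∈ = member (trans (sym (lookup∘tabulate _ x)) ([]=⇒lookup x∈))
  where
  member : does (x ≟ u) ∨ adj G u x ≡ true → x ≡ u ⊎ Edge G u x
  member h with x ≟ u
  ... | yes x≡u = inj₁ x≡u
  ... | no _    = inj₂ h

⊈-witness : {p q : Subset n} → p ⊈ q → ∃[ x ] (x ∈ p × x ∉ q)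
⊈-witness {n = n} {p} {q} p⊈q
  with ¬∀⟶∃¬ n (λ x → x ∈ p → x ∈ q) (λ x → x ∈? p →-dec x ∈? q) (λ p⊆q → p⊈q λ {x} → p⊆q x)
... | x , x∉p⇒q with x ∈? p
...   | yes x∈p = x , x∈p , λ x∈q → x∉p⇒q λ _ → x∈q
...   | no x∉p  = ⊥-elim (x∉p⇒q λ x∈p → ⊥-elim (x∉p x∈p))

p⊆q⇒∣q∣≤∣p∣⇒q⊆p : {p q : Subset n} → p ⊆ q → ∣ q ∣ ≤ ∣ p ∣ → q ⊆ p
p⊆q⇒∣q∣≤∣p∣⇒q⊆p {p = p} {q} p⊆q ∣q∣≤∣p∣ with q ⊆? p
... | yes q⊆p = q⊆p
... | no q⊈p  = ⊥-elim (≤⇒≯ ∣q∣≤∣p∣ (p⊂q⇒∣p∣<∣q∣ (p⊆q , ⊈-witness q⊈p)))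

Nested : Graph → Set
Nested G = ∀ u v → Edge G u v → closedNbhd G u ⊆ closedNbhd G v ⊎ closedNbhd G v ⊆ closedNbhd G u

module _ {m} {f : Fin m → Vertex G} {f-inj : Injective _≡_ _≡_ f} where

  closedNbhd-induced⁺ : ∀ {u x} → x ∈ closedNbhd (induced G m f f-inj) u → f x ∈ closedNbhd G (f u)
  closedNbhd-induced⁺ x∈ with ∈-closedNbhd⁻ (induced G m f f-inj) x∈
  ... | inj₁ refl = ∈-closedNbhd⁺ G (inj₁ refl)
  ... | inj₂ e    = ∈-closedNbhd⁺ G (inj₂ e)

  closedNbhd-induced⁻ : ∀ {u x} → f x ∈ closedNbhd G (f u) → x ∈ closedNbhd (induced G m f f-inj) u
  closedNbhd-induced⁻ fx∈ with ∈-closedNbhd⁻ G fx∈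
  ... | inj₁ fx≡fu = ∈-closedNbhd⁺ (induced G m f f-inj) (inj₁ (f-inj fx≡fu))
  ... | inj₂ e     = ∈-closedNbhd⁺ (induced G m f f-inj) (inj₂ e)

  nested-induced : Nested G → Nested (induced G m f f-inj)
  nested-induced nested u v e = Sum.map restrict restrict (nested (f u) (f v) e)
    where
    restrict : ∀ {u′ v′} → closedNbhd G (f u′) ⊆ closedNbhd G (f v′) →
               closedNbhd (induced G m f f-inj) u′ ⊆ closedNbhd (induced G m f f-inj) v′
    restrict ⊆ x∈ = closedNbhd-induced⁻ (⊆ (closedNbhd-induced⁺ x∈))

  clique-induced : HasClique (induced G m f f-inj) k → HasClique G k
  clique-induced (g , edges) = f ∘ g , edges

-- Graphs with nested neighborhoods satisfy ω = χ

Simplicial : (G : Graph) → Vertex G → Set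
Simplicial G v = ∀ {x y} → Edge G v x → Edge G v y → x ≢ y → Edge G x y

nested∧minimal⇒simplicial : Nested G → ∀ {v} → (∀ u → ∣ closedNbhd G v ∣ ≤ ∣ closedNbhd G u ∣) → Simplicial G v
nested∧minimal⇒simplicial {G = G} nested {v} minimal {x} {y} vx vy x≢y
  with ∈-closedNbhd⁻ G (N[v]⊆N[x] (∈-closedNbhd⁺ G (inj₂ vy)))
  where
  N[v]⊆N[x] : closedNbhd G v ⊆ closedNbhd G x
  N[v]⊆N[x] with nested v x vx
  ... | inj₁ ⊆ = ⊆
  ... | inj₂ ⊇ = p⊆q⇒∣q∣≤∣p∣⇒q⊆p ⊇ (minimal x)
... | inj₁ y≡x = ⊥-elim (x≢y (sym y≡x))
... | inj₂ xy  = xy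

simplicial⇒clique : ∀ {v} → Simplicial G v → (w : Fin k → Vertex G) → Injective _≡_ _≡_ w →
                    (∀ i → Edge G v (w i)) → HasClique G (suc k)
simplicial⇒clique {G = G} {k = k} {v} simplicial w w-inj vw = clique , edges
  where
  clique : Fin (suc k) → Vertex G
  clique zero    = v
  clique (suc i) = w i
  edges : ∀ i j → i ≢ j → Edge G (clique i) (clique j)
  edges zero    zero    i≢j = ⊥-elim (i≢j refl)
  edges zero    (suc j) _   = vw j
  edges (suc i) zero    _   = Edge-sym G (vw i)
  edges (suc i) (suc j) i≢j = simplicial (vw i) (vw j) (i≢j ∘ cong suc ∘ w-inj)

CliqueBound : Graph → ℕ → Set
CliqueBound G a = ∀ k → HasClique G k → k ≤ a

Colorable : Graph → ℕ → Set
Colorable G a = Σ (Vertex G → Fin a) (Proper G)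

-- If every color showed up around v, one neighbor of each color together with v would be an (a+1)-clique.
simplicial⇒freeColor : ∀ {v a} → Simplicial G v → CliqueBound G a →
  (f : Fin n → Vertex G) → Injective _≡_ _≡_ f → (c : Fin n → Fin a) → ∃[ i ] ∀ x → Edge G v (f x) → c x ≢ i
simplicial⇒freeColor {G = G} {v = v} {a} simplicial bound f f-inj c = free (all? used?)
  where
  used? : ∀ i → Dec (∃[ x ] (Edge G v (f x) × c x ≡ i))
  used? i = any? λ x → edge? G v (f x) ×-dec c x ≟ i
  free : Dec (∀ i → ∃[ x ] (Edge G v (f x) × c x ≡ i)) → ∃[ i ] ∀ x → Edge G v (f x) → c x ≢ i
  free (no ¬used) with ¬∀⟶∃¬ a _ used? ¬used
  ... | i , unused = i , λ x vx cx≡i → unused (x , vx , cx≡i)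
  free (yes used) = ⊥-elim (1+n≰n (bound (suc a) (simplicial⇒clique {G = G} simplicial w w-inj (proj₁ ∘ proj₂ ∘ used))))
    where
    w : Fin a → Vertex G
    w i = f (proj₁ (used i))
    w-inj : Injective _≡_ _≡_ w
    w-inj {i} {j} wi≡wj =
      trans (sym (proj₂ (proj₂ (used i)))) (trans (cong c (f-inj wi≡wj)) (proj₂ (proj₂ (used j))))

extendColoring : ∀ {a} {v : Vertex G} {f : Fin n → Vertex G} {f-inj : Injective _≡_ _≡_ f} →
  (∀ x → x ≢ v → ∃[ z ] f z ≡ x) → (c′ : Fin n → Fin a) → Proper (induced G n f f-inj) c′ →
  (i : Fin a) → (∀ z → Edge G v (f z) → c′ z ≢ i) → Colorable G a
extendColoring {G = G} {a = a} {v} {f} others c′ proper′ i free = c , proper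
  where
  c : Vertex G → Fin a
  c x with x ≟ v
  ... | yes _   = i
  ... | no x≢v  = c′ (proj₁ (others x x≢v))
  view : ∀ x → (x ≡ v × c x ≡ i) ⊎ ∃[ z ] (f z ≡ x × c x ≡ c′ z)
  view x with x ≟ v
  ... | yes x≡v = inj₁ (x≡v , refl)
  ... | no x≢v  = inj₂ (proj₁ (others x x≢v) , proj₂ (others x x≢v) , refl)
  proper : Proper G c
  proper x y e cx≡cy with view x | view y
  ... | inj₁ (refl , _)   | inj₁ (refl , _)   = Edge-irrefl G e refl
  ... | inj₁ (refl , cx≡i) | inj₂ (z , refl , cy≡c′z) =
    free z e (trans (sym cy≡c′z) (trans (sym cx≡cy) cx≡i))
  ... | inj₂ (z , refl , cx≡c′z) | inj₁ (refl , cy≡i) =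
    free z (Edge-sym G e) (trans (sym cx≡c′z) (trans cx≡cy cy≡i))
  ... | inj₂ (z , refl , cx≡c′z) | inj₂ (z′ , refl , cy≡c′z′) =
    proper′ z z′ e (trans (sym cx≡c′z) (trans cx≡cy cy≡c′z′))

nested⇒colorable : Nested G → ∀ {a} → CliqueBound G a → Colorable G a
nested⇒colorable {G = G} = go (size G) G refl
  where
  go : ∀ n (G : Graph) → size G ≡ n → Nested G → ∀ {a} → CliqueBound G a → Colorable G a
  go zero    G refl _ _ = (λ ()) , λ ()
  go (suc n) G refl nested {a} bound =
    extendColoring {G = G} {f = punchIn v} {f-inj = punchIn-inj} others c′ proper′ (proj₁ free) (proj₂ free)
    where
    v = argmin (λ u → ∣ closedNbhd G u ∣) 0F (allFin (suc n))
    minimal : ∀ u → ∣ closedNbhd G v ∣ ≤ ∣ closedNbhd G u ∣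
    minimal u = f[argmin]≤v⁺ {f = λ u → ∣ closedNbhd G u ∣} 0F (allFin _)
                  (inj₂ (Any.map (λ { refl → ≤-refl }) (∈-allFin u)))
    punchIn-inj : Injective _≡_ _≡_ (punchIn v)
    punchIn-inj {x} {y} = punchIn-injective v x y
    others : ∀ x → x ≢ v → ∃[ z ] punchIn v z ≡ x
    others x x≢v = punchOut (≢-sym x≢v) , punchIn-punchOut _
    G-v = induced G n (punchIn v) punchIn-inj
    rest = go n G-v refl (nested-induced {G = G} {f = punchIn v} {punchIn-inj} nested)
                          λ k → bound k ∘ clique-induced {G = G} {f = punchIn v} {punchIn-inj}
    c′ = proj₁ rest
    proper′ = proj₂ rest
    free = simplicial⇒freeColor {G = G} (nested∧minimal⇒simplicial {G = G} nested minimal)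
                                bound (punchIn v) punchIn-inj c′

colorable⇒properColoring : ∀ {a} → Colorable G a → ∃[ k ] (k ≤ a × HasProperColoring G k)
colorable⇒properColoring {a = zero} (c , proper) = 0 , ≤-refl , c , (λ ()) , proper
colorable⇒properColoring {G = G} {a = suc a} (c , proper) = shrink (all? used?)
  where
  used? : ∀ i → Dec (∃[ x ] c x ≡ i)
  used? i = any? λ x → c x ≟ i
  shrink : Dec (Surjective c) → ∃[ k ] (k ≤ suc a × HasProperColoring G k)
  shrink (yes surj) = suc a , ≤-refl , c , surj , proper
  shrink (no ¬surj) with ¬∀⟶∃¬ _ _ used? ¬surj
  ... | i , unused with colorable⇒properColoring {G = G} (c′ , proper′)
    where
    avoids : ∀ x → i ≢ c x
    avoids x i≡cx = unused (x , sym i≡cx)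
    c′ : Vertex G → Fin a
    c′ x = punchOut (avoids x)
    proper′ : Proper G c′
    proper′ x y e eq = proper x y e (punchOut-injective (avoids x) (avoids y) eq)
  ...   | k , k≤a , coloring = k , m≤n⇒m≤1+n k≤a , coloring

clique≤colors : ∀ {a} → HasClique G k → Colorable G a → k ≤ a
clique≤colors (f , edges) (c , proper) = injective⇒≤ {f = c ∘ f} injective
  where
  injective : ∀ {i j} → c (f i) ≡ c (f j) → i ≡ j
  injective {i} {j} eq with i ≟ j
  ... | yes i≡j = i≡j
  ... | no i≢j  = ⊥-elim (proper (f i) (f j) (edges i j i≢j) eq)

nested⇒ω≡χ : (G : Graph) → Nested G → SameParam IsCliqueNumber IsChromaticNumber G
nested⇒ω≡χ G nested a b (clique , ω-max) ((c , _ , proper) , χ-min)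
  with colorable⇒properColoring {G = G} (nested⇒colorable {G = G} nested ω-max)
... | k , k≤a , coloring = ≤-antisym (clique≤colors {G = G} clique (c , proper)) (≤-trans (χ-min k coloring) k≤a)

-- αh-perfect graphs have nested neighborhoods

privateNeighbours⇒quad : ∀ {u v x y} → Edge G u v →
  x ∈ closedNbhd G u → x ∉ closedNbhd G v → y ∈ closedNbhd G v → y ∉ closedNbhd G u →
  Σ (InducedSubgraph G) λ S → quad (adj G x y) ≅ graphOf S
privateNeighbours⇒quad {G = G} {u} {v} {x} {y} uv x∈N[u] x∉N[v] y∈N[v] y∉N[u] =
  inducedOn (x ∷ u ∷ v ∷ y ∷ []) distinct ,
  record { to = λ i → i ; from = λ i → i ; from-to = λ _ → refl ; to-from = λ _ → refl ; adj-to = table }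
  where
  ux : Edge G u x
  ux with ∈-closedNbhd⁻ G x∈N[u]
  ... | inj₁ refl = ⊥-elim (x∉N[v] (∈-closedNbhd⁺ G (inj₂ (Edge-sym G uv))))
  ... | inj₂ e    = e
  vy : Edge G v y
  vy with ∈-closedNbhd⁻ G y∈N[v]
  ... | inj₁ refl = ⊥-elim (y∉N[u] (∈-closedNbhd⁺ G (inj₂ uv)))
  ... | inj₂ e    = e
  xv : adj G x v ≡ false
  xv = ¬-not λ e → x∉N[v] (∈-closedNbhd⁺ G (inj₂ (Edge-sym G e)))
  uy : adj G u y ≡ false
  uy = ¬-not λ e → y∉N[u] (∈-closedNbhd⁺ G (inj₂ e))
  distinct : Unique (x ∷ u ∷ v ∷ y ∷ [])
  distinct =
      (≢-sym (Edge-irrefl G ux) ∷ (λ x≡v → x∉N[v] (∈-closedNbhd⁺ G (inj₁ x≡v))) ∷ (λ { refl → x∉N[v] y∈N[v] }) ∷ [])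
    ∷ (Edge-irrefl G uv ∷ (λ { refl → y∉N[u] (∈-closedNbhd⁺ G (inj₁ refl)) }) ∷ [])
    ∷ (Edge-irrefl G vy ∷ [])
    ∷ [] ∷ []
  table : ∀ i j → adj G (lookup (x ∷ u ∷ v ∷ y ∷ []) i) (lookup (x ∷ u ∷ v ∷ y ∷ []) j) ≡ adj (quad (adj G x y)) i j
  table 0F 0F = irrefl G x
  table 0F 1F = Edge-sym G ux
  table 0F 2F = xv
  table 0F 3F = refl
  table 1F 0F = ux
  table 1F 1F = irrefl G u
  table 1F 2F = uv
  table 1F 3F = uy
  table 2F 0F = trans (adj-sym G v x) xv
  table 2F 1F = Edge-sym G uv
  table 2F 2F = irrefl G v
  table 2F 3F = vy
  table 3F 0F = trans (adj-sym G y x) (sym (∨-identityʳ _))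
  table 3F 1F = trans (adj-sym G y u) uy
  table 3F 2F = Edge-sym G vy
  table 3F 3F = irrefl G y

αh-perfect⇒nested : (G : Graph) → Perfect IsAchromaticNumber IsHadwigerNumber G → Nested G
αh-perfect⇒nested G perfect u v uv with closedNbhd G u ⊆? closedNbhd G v | closedNbhd G v ⊆? closedNbhd G u
... | yes ⊆ | _     = inj₁ ⊆
... | no _  | yes ⊇ = inj₂ ⊇
... | no ⊈  | no ⊉ with ⊈-witness ⊈ | ⊈-witness ⊉
...   | x , x∈N[u] , x∉N[v] | y , y∈N[v] , y∉N[u]
  with privateNeighbours⇒quad {G = G} uv x∈N[u] x∉N[v] y∈N[v] y∉N[u]
...     | S , iso = ⊥-elim (quad-not-αh-perfect (adj G x y)
                      λ a b α h → perfect S a b (≅-achromatic iso α) (≅-hadwiger iso h))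

corollary4 : (G : Graph) → Perfect IsAchromaticNumber IsHadwigerNumber G → Perfect IsCliqueNumber IsChromaticNumber G
corollary4 G perfect S = nested⇒ω≡χ (graphOf S) (αh-perfect⇒nested (graphOf S) αh-perfect)
  where
  αh-perfect = perfect-induced IsAchromaticNumber IsHadwigerNumber perfect S
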